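{- For arbitrary graphs $G_1$ and $G_2$ on disjoint vertex sets, \[\theta_c(G_1\cup G_2)=\begin{cases}\infty, & \text{if $G_1$ or $G_2$ is disconnected, or both $G_1,G_2$ are non-complete;}\\ |V(G_1)|, & \text{if $G_2$ is complete and $G_1$ is connected and non-complete;}\\ |V(G_2)|, & \text{if $G_1$ is complete and $G_2$ is connected and non-complete;}\\ \min\{|V(G_1)|,|V(G_2)|\}, & \text{if $G_1$ and $G_2$ are complete.}\end{cases}\]
   Context: Graphs are finite, simple, undirected. $G_1\cup G_2$ is the disjoint union of $G_1$ and $G_2$. A set $S\subseteq V(G)$ is a connected clique deletion set of $G$ if $G-S$ is a clique and $G[S]$ is connected. $\theta_c(G)$ is the minimum size of a connected clique deletion set of $G$, and $\theta_c(G)=\infty$ if none exists. -}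

module Defs where

open import Data.Nat using (ℕ; _+_)
open import Data.Bool using (Bool; true; false)
open import Data.Fin using (Fin; splitAt)
open import Data.Fin.Subset using (Subset; _∈_; _∉_; ∣_∣; ⊤)
open import Data.Sum using (_⊎_; inj₁; inj₂)
open import Data.Product using (Σ; _×_; _,_)
open import Relation.Binary.PropositionalEquality using (_≡_; _≢_)
open import Relation.Nullary using (¬_)

record Graph : Set where
  field
    order  : ℕ
    adj    : Fin order → Fin order → Bool
    sym    : ∀ u v → adj u v ≡ adj v u
    irrefl : ∀ u → adj u u ≡ false
open Graph public

-- Disjoint union: vertices of G₁ are the first |V(G₁)| elements of
-- Fin (|V(G₁)| + |V(G₂)|), those of G₂ the remaining ones.
_∪ᴳ_ : Graph → Graph → Graph
G₁ ∪ᴳ G₂ = record { order = order G₁ + order G₂ ; adj = a ; sym = s ; irrefl = i }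
  where
  a : Fin (order G₁ + order G₂) → Fin (order G₁ + order G₂) → Bool
  a u v with splitAt (order G₁) u | splitAt (order G₁) v
  ... | inj₁ x | inj₁ y = adj G₁ x y
  ... | inj₂ x | inj₂ y = adj G₂ x y
  ... | inj₁ _ | inj₂ _ = false
  ... | inj₂ _ | inj₁ _ = false
  s : ∀ u v → a u v ≡ a v u
  s u v with splitAt (order G₁) u | splitAt (order G₁) v
  ... | inj₁ x | inj₁ y = sym G₁ x y
  ... | inj₂ x | inj₂ y = sym G₂ x y
  ... | inj₁ _ | inj₂ _ = _≡_.refl
  ... | inj₂ _ | inj₁ _ = _≡_.refl
  i : ∀ u → a u u ≡ false
  i u with splitAt (order G₁) u
  ... | inj₁ x = irrefl G₁ x
  ... | inj₂ x = irrefl G₂ x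

data WalkIn (G : Graph) (S : Subset (order G)) : Fin (order G) → Fin (order G) → Set where
  here : ∀ {u} → u ∈ S → WalkIn G S u u
  step : ∀ {u v w} → u ∈ S → adj G u v ≡ true → WalkIn G S v w → WalkIn G S u w

InducedConnected : (G : Graph) → Subset (order G) → Set
InducedConnected G S = ∀ u v → u ∈ S → v ∈ S → WalkIn G S u v

Connected : Graph → Set
Connected G = InducedConnected G ⊤

Complete : Graph → Set
Complete G = ∀ u v → u ≢ v → adj G u v ≡ true

CliqueAfterDeleting : (G : Graph) → Subset (order G) → Set
CliqueAfterDeleting G S = ∀ u v → u ∉ S → v ∉ S → u ≢ v → adj G u v ≡ true

IsCCDS : (G : Graph) → Subset (order G) → Set
IsCCDS G S = CliqueAfterDeleting G S × InducedConnected G S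

data ℕ∞ : Set where
  fin : ℕ → ℕ∞
  ∞   : ℕ∞

data θc_≈_ (G : Graph) : ℕ∞ → Set where
  none : (∀ S → ¬ IsCCDS G S) → θc G ≈ ∞
  least : ∀ S → IsCCDS G S → (∀ S′ → IsCCDS G S′ → ∣ S ∣ Data.Nat.≤ ∣ S′ ∣) →
          θc G ≈ fin ∣ S ∣

{-# OPTIONS --safe #-}
-- There are no edges between V(G₁) and V(G₂), so a connected set S lies on one side, and so
-- does the clique V − S. As both sides are nonempty, S is exactly V(G₁) or V(G₂). Finally
-- V(G₁) is a connected clique deletion set iff G₁ is connected and G₂ is complete, and
-- symmetrically; θ_c is the least size among the admissible candidates.
module Submission where

open import Defs
open import Data.Bool using (Bool; true; false; not)
open import Data.Bool.Properties using (not-involutive)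
open import Data.Empty using (⊥-elim)
open import Data.Fin using (Fin; splitAt; join; _↑ˡ_; _↑ʳ_; fromℕ<) renaming (_≟_ to _≟ᶠ_)
open import Data.Fin.Properties using (splitAt-↑ˡ; splitAt-↑ʳ; join-splitAt; ↑ʳ-injective; ↑ˡ-injective)
open import Data.Fin.Subset using (Subset; _∈_; _∉_; ∣_∣; ⊤; ⊥; _⊆_)
open import Data.Fin.Subset.Properties using (_∈?_; ∈⊤; ⊆-antisym; ∣⊤∣≡n; ∣⊥∣≡0)
open import Data.Nat using (_≤_; _⊓_; _+_; suc)
open import Data.Nat.Properties using (≤-refl; ≤-total; m≤n⇒m⊓n≡m; m≥n⇒m⊓n≡n; +-identityʳ)
open import Data.Product using (_×_; _,_; proj₁; proj₂) renaming (swap to ×-swap)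
open import Data.Sum using (_⊎_; inj₁; inj₂; [_,_]′) renaming (swap to ⊎-swap; map to ⊎-map)
open import Data.Vec using (_∷_; []; _++_; lookup)
open import Data.Vec.Properties using (lookup-splitAt; lookup-replicate; []=⇒lookup; lookup⇒[]=)
open import Function using (id; const; _∘_)
open import Function.Bundles using (_⇔_; mk⇔; module Equivalence)
open import Relation.Nullary using (¬_; yes; no)
open import Relation.Binary.PropositionalEquality as ≡ using (_≡_; _≢_; refl; trans; cong; cong₂; subst; subst₂)

open Equivalence using (to; from)

true≢false : true ≢ false
true≢false ()

complete⇒connected : ∀ G → Complete G → Connected G
complete⇒connected G complete u v _ _ with u ≟ᶠ v
... | yes refl = here ∈⊤
... | no u≢v   = step ∈⊤ (complete u v u≢v) (here ∈⊤)

¬Connected⊎¬Complete⇒¬[Connected×Complete] : ∀ {G₁ G₂} →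
  (¬ Connected G₁ ⊎ ¬ Connected G₂) ⊎ (¬ Complete G₁ × ¬ Complete G₂) →
  ¬ (Connected G₁ × Complete G₂)
¬Connected⊎¬Complete⇒¬[Connected×Complete] (inj₁ (inj₁ ¬connected₁)) (connected₁ , _) =
  ¬connected₁ connected₁
¬Connected⊎¬Complete⇒¬[Connected×Complete] {G₂ = G₂} (inj₁ (inj₂ ¬connected₂)) (_ , complete₂) =
  ¬connected₂ (complete⇒connected G₂ complete₂)
¬Connected⊎¬Complete⇒¬[Connected×Complete] (inj₂ (_ , ¬complete₂)) (_ , complete₂) =
  ¬complete₂ complete₂

WalkIn-map : ∀ {G H S T} (f : Fin (order G) → Fin (order H)) →
             (∀ {u} → u ∈ S → f u ∈ T) →
             (∀ {u v} → u ∈ S → adj G u v ≡ true → adj H (f u) (f v) ≡ true) →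
             ∀ {u w} → WalkIn G S u w → WalkIn H T (f u) (f w)
WalkIn-map f f-∈ f-adj (here u∈S)      = here (f-∈ u∈S)
WalkIn-map f f-∈ f-adj (step u∈S uv w) = step (f-∈ u∈S) (f-adj u∈S uv) (WalkIn-map f f-∈ f-adj w)

module _ {G : Graph} {A : Set} (f : Fin (order G) → A)
         (f-adj : ∀ {u v} → adj G u v ≡ true → f u ≡ f v) where

  WalkIn-invariant : ∀ {S u w} → WalkIn G S u w → f u ≡ f w
  WalkIn-invariant (here _)      = refl
  WalkIn-invariant (step _ uv w) = trans (f-adj uv) (WalkIn-invariant w)

  CliqueAfterDeleting-invariant : ∀ {S} → CliqueAfterDeleting G S →
                                  ∀ {u v} → u ∉ S → v ∉ S → f u ≡ f v
  CliqueAfterDeleting-invariant clique {u} {v} u∉S v∉S with u ≟ᶠ v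
  ... | yes refl = refl
  ... | no u≢v   = f-adj (clique u v u∉S v∉S u≢v)

∣p++q∣≡∣p∣+∣q∣ : ∀ {m n} (p : Subset m) (q : Subset n) → ∣ p ++ q ∣ ≡ ∣ p ∣ + ∣ q ∣
∣p++q∣≡∣p∣+∣q∣ []          q = refl
∣p++q∣≡∣p∣+∣q∣ (true ∷ p)  q = cong suc (∣p++q∣≡∣p∣+∣q∣ p q)
∣p++q∣≡∣p∣+∣q∣ (false ∷ p) q = ∣p++q∣≡∣p∣+∣q∣ p q

≡-by-lookup : ∀ {n} {S T : Subset n} →
              (∀ {u} → u ∈ S → lookup T u ≡ true) → (∀ {u} → u ∉ S → lookup T u ≡ false) → S ≡ T
≡-by-lookup {S = S} {T} ∈S⇒true ∉S⇒false = ⊆-antisym (λ {u} u∈S → lookup⇒[]= u T (∈S⇒true u∈S)) T⊆S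
  where
  T⊆S : T ⊆ S
  T⊆S {u} u∈T with u ∈? S
  ... | yes u∈S = u∈S
  ... | no u∉S  = ⊥-elim (true≢false (trans (≡.sym ([]=⇒lookup u∈T)) (∉S⇒false u∉S)))

θc-least-candidate : ∀ {G A B} → (∀ S → IsCCDS G S → S ≡ A ⊎ S ≡ B) →
                     IsCCDS G A → (IsCCDS G B → ∣ A ∣ ≤ ∣ B ∣) → θc G ≈ fin ∣ A ∣
θc-least-candidate {G} {A} candidates A-ccds B-ccds⇒A≤B = least A A-ccds minimal
  where
  minimal : ∀ S → IsCCDS G S → ∣ A ∣ ≤ ∣ S ∣
  minimal S S-ccds with candidates S S-ccds
  ... | inj₁ refl = ≤-refl
  ... | inj₂ refl = B-ccds⇒A≤B S-ccds

θc-⊓ : ∀ {G A B} → (∀ S → IsCCDS G S → S ≡ A ⊎ S ≡ B) →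
       IsCCDS G A → IsCCDS G B → θc G ≈ fin (∣ A ∣ ⊓ ∣ B ∣)
θc-⊓ {A = A} {B} candidates A-ccds B-ccds with ≤-total ∣ A ∣ ∣ B ∣
... | inj₁ A≤B rewrite m≤n⇒m⊓n≡m A≤B =
  θc-least-candidate candidates A-ccds (const A≤B)
... | inj₂ B≤A rewrite m≥n⇒m⊓n≡n B≤A =
  θc-least-candidate (λ S → ⊎-swap ∘ candidates S) B-ccds (const B≤A)

module Union (G₁ G₂ : Graph) where

  private
    n₁ = order G₁
    n₂ = order G₂

  G : Graph
  G = G₁ ∪ᴳ G₂

  inl : Fin n₁ → Fin (n₁ + n₂)
  inl i = i ↑ˡ n₂

  inr : Fin n₂ → Fin (n₁ + n₂)
  inr j = n₁ ↑ʳ j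

  data Vertex : Fin (n₁ + n₂) → Set where
    left  : ∀ i → Vertex (inl i)
    right : ∀ j → Vertex (inr j)

  vertex : ∀ u → Vertex u
  vertex u = subst Vertex (join-splitAt n₁ n₂ u) (fromSplit (splitAt n₁ u))
    where
    fromSplit : (s : Fin n₁ ⊎ Fin n₂) → Vertex (join n₁ n₂ s)
    fromSplit (inj₁ i) = left i
    fromSplit (inj₂ j) = right j

  adj-inl : ∀ i i′ → adj G (inl i) (inl i′) ≡ adj G₁ i i′
  adj-inl i i′ rewrite splitAt-↑ˡ n₁ i n₂ | splitAt-↑ˡ n₁ i′ n₂ = refl

  adj-inr : ∀ j j′ → adj G (inr j) (inr j′) ≡ adj G₂ j j′
  adj-inr j j′ rewrite splitAt-↑ʳ n₁ n₂ j | splitAt-↑ʳ n₁ n₂ j′ = refl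

  side : Fin (n₁ + n₂) → Bool
  side u = [ const true , const false ]′ (splitAt n₁ u)

  side-inl : ∀ i → side (inl i) ≡ true
  side-inl i rewrite splitAt-↑ˡ n₁ i n₂ = refl

  side-inr : ∀ j → side (inr j) ≡ false
  side-inr j rewrite splitAt-↑ʳ n₁ n₂ j = refl

  adj⇒side≡ : ∀ {u v} → adj G u v ≡ true → side u ≡ side v
  adj⇒side≡ {u} {v} _ with splitAt n₁ u | splitAt n₁ v
  adj⇒side≡ _  | inj₁ _ | inj₁ _ = refl
  adj⇒side≡ _  | inj₂ _ | inj₂ _ = refl
  adj⇒side≡ () | inj₁ _ | inj₂ _
  adj⇒side≡ () | inj₂ _ | inj₁ _

  -- A retraction onto V(G₁); default is its junk value on the vertices of G₂.
  toG₁ : Fin n₁ → Fin (n₁ + n₂) → Fin n₁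
  toG₁ default u = [ id , const default ]′ (splitAt n₁ u)

  toG₁-inl : ∀ default i → toG₁ default (inl i) ≡ i
  toG₁-inl default i rewrite splitAt-↑ˡ n₁ i n₂ = refl

  toG₁-adj : ∀ default {u v} → side u ≡ true → adj G u v ≡ true →
             adj G₁ (toG₁ default u) (toG₁ default v) ≡ true
  toG₁-adj default {u} {v} _ _ with splitAt n₁ u | splitAt n₁ v
  toG₁-adj default _  uv | inj₁ _ | inj₁ _ = uv
  toG₁-adj default _  () | inj₁ _ | inj₂ _
  toG₁-adj default () _  | inj₂ _ | _

  toG₂ : Fin n₂ → Fin (n₁ + n₂) → Fin n₂
  toG₂ default u = [ const default , id ]′ (splitAt n₁ u)

  toG₂-inr : ∀ default j → toG₂ default (inr j) ≡ j
  toG₂-inr default j rewrite splitAt-↑ʳ n₁ n₂ j = refl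

  toG₂-adj : ∀ default {u v} → side u ≡ false → adj G u v ≡ true →
             adj G₂ (toG₂ default u) (toG₂ default v) ≡ true
  toG₂-adj default {u} {v} _ _ with splitAt n₁ u | splitAt n₁ v
  toG₂-adj default _  uv | inj₂ _ | inj₂ _ = uv
  toG₂-adj default _  () | inj₂ _ | inj₁ _
  toG₂-adj default () _  | inj₁ _ | _

  V₁ V₂ : Subset (n₁ + n₂)
  V₁ = ⊤ {n = n₁} ++ ⊥ {n = n₂}
  V₂ = ⊥ {n = n₁} ++ ⊤ {n = n₂}

  ∣V₁∣≡n₁ : ∣ V₁ ∣ ≡ n₁
  ∣V₁∣≡n₁ = begin
    ∣ V₁ ∣                           ≡⟨ ∣p++q∣≡∣p∣+∣q∣ (⊤ {n = n₁}) ⊥ ⟩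
    ∣ ⊤ {n = n₁} ∣ + ∣ ⊥ {n = n₂} ∣  ≡⟨ cong₂ _+_ (∣⊤∣≡n n₁) (∣⊥∣≡0 n₂) ⟩
    n₁ + 0                           ≡⟨ +-identityʳ n₁ ⟩
    n₁                               ∎
    where open ≡.≡-Reasoning

  ∣V₂∣≡n₂ : ∣ V₂ ∣ ≡ n₂
  ∣V₂∣≡n₂ = trans (∣p++q∣≡∣p∣+∣q∣ (⊥ {n = n₁}) ⊤) (cong₂ _+_ (∣⊥∣≡0 n₁) (∣⊤∣≡n n₂))

  lookup-V₁ : ∀ u → lookup V₁ u ≡ side u
  lookup-V₁ u rewrite lookup-splitAt n₁ ⊤ ⊥ u with splitAt n₁ u
  ... | inj₁ i = lookup-replicate i true
  ... | inj₂ j = lookup-replicate j false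

  lookup-V₂ : ∀ u → lookup V₂ u ≡ not (side u)
  lookup-V₂ u rewrite lookup-splitAt n₁ ⊥ ⊤ u with splitAt n₁ u
  ... | inj₁ i = lookup-replicate i false
  ... | inj₂ j = lookup-replicate j true

  ∈V₁⇒side : ∀ {u} → u ∈ V₁ → side u ≡ true
  ∈V₁⇒side {u} u∈V₁ = trans (≡.sym (lookup-V₁ u)) ([]=⇒lookup u∈V₁)

  ∈V₂⇒side : ∀ {u} → u ∈ V₂ → side u ≡ false
  ∈V₂⇒side {u} u∈V₂ =
    trans (≡.sym (not-involutive (side u))) (cong not (trans (≡.sym (lookup-V₂ u)) ([]=⇒lookup u∈V₂)))

  inl∈V₁ : ∀ i → inl i ∈ V₁
  inl∈V₁ i = lookup⇒[]= (inl i) V₁ (trans (lookup-V₁ (inl i)) (side-inl i))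

  inr∉V₁ : ∀ j → inr j ∉ V₁
  inr∉V₁ j j∈V₁ = true≢false (trans (≡.sym (∈V₁⇒side j∈V₁)) (side-inr j))

  inr∈V₂ : ∀ j → inr j ∈ V₂
  inr∈V₂ j = lookup⇒[]= (inr j) V₂ (trans (lookup-V₂ (inr j)) (cong not (side-inr j)))

  inl∉V₂ : ∀ i → inl i ∉ V₂
  inl∉V₂ i i∈V₂ = true≢false (trans (≡.sym (side-inl i)) (∈V₂⇒side i∈V₂))

  isCCDS-V₁ : IsCCDS G V₁ ⇔ (Connected G₁ × Complete G₂)
  isCCDS-V₁ = mk⇔ (λ (clique , connected) → G₁-connected connected , G₂-complete clique)
                  (λ (connected , complete) → V₁-cocomplete complete , V₁-connected connected)
    where
    G₁-connected : InducedConnected G V₁ → Connected G₁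
    G₁-connected connected i i′ _ _ =
      subst₂ (WalkIn G₁ ⊤) (toG₁-inl i i) (toG₁-inl i i′)
        (WalkIn-map (toG₁ i) (const ∈⊤) (toG₁-adj i ∘ ∈V₁⇒side)
          (connected (inl i) (inl i′) (inl∈V₁ i) (inl∈V₁ i′)))

    G₂-complete : CliqueAfterDeleting G V₁ → Complete G₂
    G₂-complete clique j j′ j≢j′ = trans (≡.sym (adj-inr j j′))
      (clique (inr j) (inr j′) (inr∉V₁ j) (inr∉V₁ j′) (j≢j′ ∘ ↑ʳ-injective n₁ j j′))

    V₁-cocomplete : Complete G₂ → CliqueAfterDeleting G V₁
    V₁-cocomplete complete u v u∉V₁ v∉V₁ u≢v with vertex u | vertex v
    ... | left i  | _        = ⊥-elim (u∉V₁ (inl∈V₁ i))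
    ... | right _ | left i′  = ⊥-elim (v∉V₁ (inl∈V₁ i′))
    ... | right j | right j′ = trans (adj-inr j j′) (complete j j′ λ { refl → u≢v refl })

    V₁-connected : Connected G₁ → InducedConnected G V₁
    V₁-connected connected u v u∈V₁ v∈V₁ with vertex u | vertex v
    ... | right j | _        = ⊥-elim (inr∉V₁ j u∈V₁)
    ... | left _  | right j′ = ⊥-elim (inr∉V₁ j′ v∈V₁)
    ... | left i  | left i′  = WalkIn-map inl (λ {k} _ → inl∈V₁ k)
                                 (λ {k} {k′} _ kk′ → trans (adj-inl k k′) kk′) (connected i i′ ∈⊤ ∈⊤)

  isCCDS-V₂ : IsCCDS G V₂ ⇔ (Connected G₂ × Complete G₁)
  isCCDS-V₂ = mk⇔ (λ (clique , connected) → G₂-connected connected , G₁-complete clique)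
                  (λ (connected , complete) → V₂-cocomplete complete , V₂-connected connected)
    where
    G₂-connected : InducedConnected G V₂ → Connected G₂
    G₂-connected connected j j′ _ _ =
      subst₂ (WalkIn G₂ ⊤) (toG₂-inr j j) (toG₂-inr j j′)
        (WalkIn-map (toG₂ j) (const ∈⊤) (toG₂-adj j ∘ ∈V₂⇒side)
          (connected (inr j) (inr j′) (inr∈V₂ j) (inr∈V₂ j′)))

    G₁-complete : CliqueAfterDeleting G V₂ → Complete G₁
    G₁-complete clique i i′ i≢i′ = trans (≡.sym (adj-inl i i′))
      (clique (inl i) (inl i′) (inl∉V₂ i) (inl∉V₂ i′) (i≢i′ ∘ ↑ˡ-injective n₂ i i′))

    V₂-cocomplete : Complete G₁ → CliqueAfterDeleting G V₂
    V₂-cocomplete complete u v u∉V₂ v∉V₂ u≢v with vertex u | vertex v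
    ... | right j | _        = ⊥-elim (u∉V₂ (inr∈V₂ j))
    ... | left _  | right j′ = ⊥-elim (v∉V₂ (inr∈V₂ j′))
    ... | left i  | left i′  = trans (adj-inl i i′) (complete i i′ λ { refl → u≢v refl })

    V₂-connected : Connected G₂ → InducedConnected G V₂
    V₂-connected connected u v u∈V₂ v∈V₂ with vertex u | vertex v
    ... | left i  | _        = ⊥-elim (inl∉V₂ i u∈V₂)
    ... | right _ | left i′  = ⊥-elim (inl∉V₂ i′ v∈V₂)
    ... | right j | right j′ = WalkIn-map inr (λ {k} _ → inr∈V₂ k)
                                 (λ {k} {k′} _ kk′ → trans (adj-inr k k′) kk′) (connected j j′ ∈⊤ ∈⊤)

  module _ {S : Subset (n₁ + n₂)} (S-ccds : IsCCDS G S) where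

    ∈S⇒side≡ : ∀ {u v} → u ∈ S → v ∈ S → side u ≡ side v
    ∈S⇒side≡ u∈S v∈S = WalkIn-invariant side adj⇒side≡ (proj₂ S-ccds _ _ u∈S v∈S)

    ∉S⇒side≡ : ∀ {u v} → u ∉ S → v ∉ S → side u ≡ side v
    ∉S⇒side≡ = CliqueAfterDeleting-invariant {G = G} side adj⇒side≡ (proj₁ S-ccds)

    inl∈S⇒S≡V₁ : ∀ {i} → Fin n₂ → inl i ∈ S → S ≡ V₁
    inl∈S⇒S≡V₁ {i} j i∈S = ≡-by-lookup
      (λ {u} u∈S → trans (lookup-V₁ u) (trans (∈S⇒side≡ u∈S i∈S) (side-inl i)))
      (λ {u} u∉S → trans (lookup-V₁ u) (trans (∉S⇒side≡ u∉S j∉S) (side-inr j)))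
      where
      j∉S : inr j ∉ S
      j∉S j∈S = true≢false (trans (≡.sym (side-inl i)) (trans (∈S⇒side≡ i∈S j∈S) (side-inr j)))

    inl∉S⇒S≡V₂ : ∀ {i} → Fin n₂ → inl i ∉ S → S ≡ V₂
    inl∉S⇒S≡V₂ {i} j i∉S = ≡-by-lookup
      (λ {u} u∈S → trans (lookup-V₂ u) (cong not (trans (∈S⇒side≡ u∈S j∈S) (side-inr j))))
      (λ {u} u∉S → trans (lookup-V₂ u) (cong not (trans (∉S⇒side≡ u∉S i∉S) (side-inl i))))
      where
      j∈S : inr j ∈ S
      j∈S with inr j ∈? S
      ... | yes j∈S = j∈S
      ... | no j∉S  = ⊥-elim (true≢false (trans (≡.sym (side-inl i)) (trans (∉S⇒side≡ i∉S j∉S) (side-inr j))))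

  isCCDS⇒≡V₁⊎≡V₂ : Fin n₁ → Fin n₂ → ∀ {S} → IsCCDS G S → S ≡ V₁ ⊎ S ≡ V₂
  isCCDS⇒≡V₁⊎≡V₂ i j {S} S-ccds with inl i ∈? S
  ... | yes i∈S = inj₁ (inl∈S⇒S≡V₁ S-ccds j i∈S)
  ... | no i∉S  = inj₂ (inl∉S⇒S≡V₂ S-ccds j i∉S)

lemma20 : (G₁ G₂ : Graph) → 1 ≤ order G₁ → 1 ≤ order G₂ →
    ((¬ Connected G₁ ⊎ ¬ Connected G₂) ⊎ (¬ Complete G₁ × ¬ Complete G₂) → θc (G₁ ∪ᴳ G₂) ≈ ∞)
    × (Complete G₂ × Connected G₁ × ¬ Complete G₁ → θc (G₁ ∪ᴳ G₂) ≈ fin (order G₁))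
    × (Complete G₁ × Connected G₂ × ¬ Complete G₂ → θc (G₁ ∪ᴳ G₂) ≈ fin (order G₂))
    × (Complete G₁ × Complete G₂ → θc (G₁ ∪ᴳ G₂) ≈ fin (order G₁ ⊓ order G₂))
lemma20 G₁ G₂ 1≤n₁ 1≤n₂ = infinite , only-V₁ , only-V₂ , both
  where
  open Union G₁ G₂

  candidates : ∀ S → IsCCDS G S → S ≡ V₁ ⊎ S ≡ V₂
  candidates S = isCCDS⇒≡V₁⊎≡V₂ (fromℕ< 1≤n₁) (fromℕ< 1≤n₂)

  infinite : (¬ Connected G₁ ⊎ ¬ Connected G₂) ⊎ (¬ Complete G₁ × ¬ Complete G₂) → θc G ≈ ∞
  infinite h = none λ S S-ccds → [ (λ { refl → ¬V₁ (to isCCDS-V₁ S-ccds) })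
                                  , (λ { refl → ¬V₂ (to isCCDS-V₂ S-ccds) }) ]′ (candidates S S-ccds)
    where
    ¬V₁ : ¬ (Connected G₁ × Complete G₂)
    ¬V₁ = ¬Connected⊎¬Complete⇒¬[Connected×Complete] h
    ¬V₂ : ¬ (Connected G₂ × Complete G₁)
    ¬V₂ = ¬Connected⊎¬Complete⇒¬[Connected×Complete] (⊎-map ⊎-swap ×-swap h)

  only-V₁ : Complete G₂ × Connected G₁ × ¬ Complete G₁ → θc G ≈ fin (order G₁)
  only-V₁ (complete₂ , connected₁ , ¬complete₁) = subst (λ k → θc G ≈ fin k) ∣V₁∣≡n₁
    (θc-least-candidate candidates (from isCCDS-V₁ (connected₁ , complete₂))
      (⊥-elim ∘ ¬complete₁ ∘ proj₂ ∘ to isCCDS-V₂))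

  only-V₂ : Complete G₁ × Connected G₂ × ¬ Complete G₂ → θc G ≈ fin (order G₂)
  only-V₂ (complete₁ , connected₂ , ¬complete₂) = subst (λ k → θc G ≈ fin k) ∣V₂∣≡n₂
    (θc-least-candidate (λ S → ⊎-swap ∘ candidates S) (from isCCDS-V₂ (connected₂ , complete₁))
      (⊥-elim ∘ ¬complete₂ ∘ proj₂ ∘ to isCCDS-V₁))

  both : Complete G₁ × Complete G₂ → θc G ≈ fin (order G₁ ⊓ order G₂)
  both (complete₁ , complete₂) = subst (λ k → θc G ≈ fin k) (cong₂ _⊓_ ∣V₁∣≡n₁ ∣V₂∣≡n₂)
    (θc-⊓ candidates (from isCCDS-V₁ (complete⇒connected G₁ complete₁ , complete₂))
                     (from isCCDS-V₂ (complete⇒connected G₂ complete₂ , complete₁)))
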